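{- Let $d\ge 1$ be an integer and $x,y\ge 0$ reals. Then \[ (dx+1)^{d+1}(dy+1)^{d+1}\le\bigl((d+1)dxy+(d+1)(x+y)+1\bigr)^{2d}, \] with equality if and only if $x=y=0$. -}

module Defs where

open import Level using (Level; suc; _⊔_)
open import Data.Nat using (ℕ; zero) renaming (suc to sucℕ)
open import Data.Product using (Σ; _×_; ∃)
open import Relation.Binary.PropositionalEquality using (_≡_)
open import Relation.Binary.Structures using (IsTotalOrder)
open import Relation.Nullary using (¬_)
open import Algebra.Core using (Op₁; Op₂)
import Algebra.Structures as AS

-- The real numbers, axiomatised (as usual) as a Dedekind-complete ordered
-- field: a commutative ring with a compatible total order, 0 ≠ 1,
-- multiplicative inverses of non-zero elements, and the least-upper-bound
-- property for nonempty bounded-above subsets (subsets = predicates).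
record RealField (c : Level) : Set (suc c) where
  infixl 6 _+_
  infixl 7 _*_
  infix  4 _≤_
  field
    Carrier : Set c
    _+_ _*_ : Op₂ Carrier
    -_      : Op₁ Carrier
    0# 1#   : Carrier
    _≤_     : Carrier → Carrier → Set c
    isCommutativeRing : AS.IsCommutativeRing {A = Carrier} _≡_ _+_ _*_ -_ 0# 1#
    isTotalOrder      : IsTotalOrder _≡_ _≤_
    +-mono-≤  : ∀ {x y} z → x ≤ y → x + z ≤ y + z
    *-nonneg  : ∀ {x y} → 0# ≤ x → 0# ≤ y → 0# ≤ x * y
    0≢1       : ¬ (0# ≡ 1#)
    inverse   : ∀ x → ¬ (x ≡ 0#) → ∃ λ y → x * y ≡ 1#
    completeness : (P : Carrier → Set c) → ∃ P → (∃ λ b → ∀ x → P x → x ≤ b) →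
                   ∃ λ s → (∀ x → P x → x ≤ s) × (∀ b → (∀ x → P x → x ≤ b) → s ≤ b)

module _ {c : Level} (R : RealField c) where
  open RealField R

  fromℕ : ℕ → Carrier
  fromℕ zero = 0#
  fromℕ (sucℕ n) = 1# + fromℕ n

  _^_ : Carrier → ℕ → Carrier
  x ^ zero = 1#
  x ^ sucℕ n = x * (x ^ n)

-- Put t = (dx+1)(dy+1) ≥ 1 and g = x + y + dxy ≥ 0. The base on the right is exactly t + g,
-- so as d + 1 ≤ 2d the left side t^(d+1) is at most t^(2d) ≤ (t+g)^(2d). Moreover
-- (t+g)^(k+1) ≥ t^(k+1) + g when t ≥ 1, so equality forces g = 0, i.e. x = y = 0.
module Submission where

open import Defs using (RealField)
open import Level using (Level)
open import Data.Nat using (ℕ) renaming (_+_ to _+ℕ_; _*_ to _*ℕ_; _≤_ to _≤ℕ_)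
open import Data.Product using (_×_)
open import Relation.Binary.PropositionalEquality using (_≡_)

open import Data.Nat using (zero; z≤n; s≤s) renaming (suc to sucℕ)
import Data.Nat.Properties as ℕ
open import Data.Product using (∃; _,_)
open import Data.Sum using (inj₁; inj₂)
open import Relation.Nullary using (contradiction)
open import Relation.Binary.PropositionalEquality using (refl; sym; trans; cong; cong₂; subst; subst₂; module ≡-Reasoning)
open import Relation.Binary.Structures using (IsTotalOrder)
open import Relation.Binary.Bundles using (Poset)
import Relation.Binary.Reasoning.PartialOrder
open import Algebra.Bundles using (CommutativeRing)
import Algebra.Structures as AS

n+1≤2n : ∀ {n} → 1 ≤ℕ n → n +ℕ 1 ≤ℕ 2 *ℕ n
n+1≤2n {n} 1≤n = subst (n +ℕ 1 ≤ℕ_) (cong (n +ℕ_) (sym (ℕ.+-identityʳ n))) (ℕ.+-monoʳ-≤ n 1≤n)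

module RealFieldProperties {c : Level} (R : RealField c) where
  open RealField R
  open AS.IsCommutativeRing isCommutativeRing
    using (+-comm; +-assoc; +-identityʳ; +-identityˡ; *-identityʳ; -‿inverseʳ; distribʳ)
  open IsTotalOrder isTotalOrder
    using () renaming (refl to ≤-refl; trans to ≤-trans; antisym to ≤-antisym; total to ≤-total)

  poset : Poset c c c
  poset = record { isPartialOrder = IsTotalOrder.isPartialOrder isTotalOrder }

  module ≤-Reasoning = Relation.Binary.Reasoning.PartialOrder poset

  commutativeRing : CommutativeRing c c
  commutativeRing = record { isCommutativeRing = isCommutativeRing }

  open import Algebra.Solver.Ring.NaturalCoefficients.Default
    (CommutativeRing.commutativeSemiring commutativeRing)

  fromℕ : ℕ → Carrier
  fromℕ = Defs.fromℕ R

  infixr 8 _^_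
  _^_ : Carrier → ℕ → Carrier
  _^_ = Defs._^_ R

  +-monoʳ-≤ : ∀ z {x y} → x ≤ y → z + x ≤ z + y
  +-monoʳ-≤ z {x} {y} x≤y = subst₂ _≤_ (+-comm x z) (+-comm y z) (+-mono-≤ z x≤y)

  x≤x+y : ∀ x {y} → 0# ≤ y → x ≤ x + y
  x≤x+y x {y} 0≤y = subst (_≤ x + y) (+-identityʳ x) (+-monoʳ-≤ x 0≤y)

  x≤y+x : ∀ x {y} → 0# ≤ y → x ≤ y + x
  x≤y+x x {y} 0≤y = subst (x ≤_) (+-comm x y) (x≤x+y x 0≤y)

  +-nonneg : ∀ {x y} → 0# ≤ x → 0# ≤ y → 0# ≤ x + y
  +-nonneg {x} 0≤x 0≤y = ≤-trans 0≤x (x≤x+y x 0≤y)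

  x+y-x≡y : ∀ x y → x + y + - x ≡ y
  x+y-x≡y x y = begin
    x + y + - x   ≡⟨ solve 3 (λ x y z → x :+ y :+ z := y :+ (x :+ z)) refl x y (- x) ⟩
    y + (x + - x) ≡⟨ cong (y +_) (-‿inverseʳ x) ⟩
    y + 0#        ≡⟨ +-identityʳ y ⟩
    y             ∎
    where open ≡-Reasoning

  ≤⇒nonneg-difference : ∀ {x y} → x ≤ y → ∃ λ e → 0# ≤ e × y ≡ x + e
  ≤⇒nonneg-difference {x} {y} x≤y =
    y + - x ,
    subst (_≤ y + - x) (-‿inverseʳ x) (+-mono-≤ (- x) x≤y) ,
    sym (trans (sym (+-assoc x y (- x))) (x+y-x≡y x y))

  x+y≤x⇒y≤0 : ∀ {x y} → x + y ≤ x → y ≤ 0#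
  x+y≤x⇒y≤0 {x} {y} x+y≤x = subst₂ _≤_ (x+y-x≡y x y) (-‿inverseʳ x) (+-mono-≤ (- x) x+y≤x)

  x+y≡0⇒x≡0 : ∀ {x y} → 0# ≤ x → 0# ≤ y → x + y ≡ 0# → x ≡ 0#
  x+y≡0⇒x≡0 {x} 0≤x 0≤y x+y≡0 = ≤-antisym (subst (x ≤_) x+y≡0 (x≤x+y x 0≤y)) 0≤x

  x+y≡0⇒y≡0 : ∀ {x y} → 0# ≤ x → 0# ≤ y → x + y ≡ 0# → y ≡ 0#
  x+y≡0⇒y≡0 {x} {y} 0≤x 0≤y x+y≡0 = x+y≡0⇒x≡0 0≤y 0≤x (trans (+-comm y x) x+y≡0)

  *-mono-≤ : ∀ {x y u v} → 0# ≤ x → x ≤ y → 0# ≤ u → u ≤ v → x * u ≤ y * v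
  *-mono-≤ {x} {y} {u} {v} 0≤x x≤y 0≤u u≤v
    with ≤⇒nonneg-difference x≤y | ≤⇒nonneg-difference u≤v
  ... | e , 0≤e , refl | f , 0≤f , refl =
    subst (x * u ≤_) (sym expand)
      (x≤x+y (x * u) (+-nonneg (+-nonneg (*-nonneg 0≤x 0≤f) (*-nonneg 0≤e 0≤u)) (*-nonneg 0≤e 0≤f)))
    where
    expand : (x + e) * (u + f) ≡ x * u + (x * f + e * u + e * f)
    expand = solve 4 (λ x u e f → (x :+ e) :* (u :+ f) := x :* u :+ (x :* f :+ e :* u :+ e :* f))
               refl x u e f

  -- If 1 ≤ 0, write 0 = 1 + e with 0 ≤ e; then e * e = 1, so 0 ≤ 1 after all.
  0≤1 : 0# ≤ 1#
  0≤1 with ≤-total 0# 1#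
  ... | inj₁ 0≤1 = 0≤1
  ... | inj₂ 1≤0 with ≤⇒nonneg-difference 1≤0
  ...   | e , 0≤e , 0≡1+e =
    contradiction (≤-antisym (subst (0# ≤_) e*e≡1 (*-nonneg 0≤e 0≤e)) 1≤0) 0≢1
    where
    open ≡-Reasoning
    e*e≡1 : e * e ≡ 1#
    e*e≡1 = begin
      e * e              ≡⟨ sym (+-identityˡ (e * e)) ⟩
      0# + e * e         ≡⟨ cong (_+ e * e) 0≡1+e ⟩
      1# + e + e * e     ≡⟨ solve 1 (λ e → con 1 :+ e :+ e :* e := con 1 :+ e :* (con 1 :+ e)) refl e ⟩
      1# + e * (1# + e)  ≡⟨ cong (λ z → 1# + e * z) (sym 0≡1+e) ⟩
      1# + e * 0#        ≡⟨ solve 1 (λ e → con 1 :+ e :* con 0 := con 1) refl e ⟩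
      1#                 ∎

  1≤x⇒1≤y⇒1≤x*y : ∀ {x y} → 1# ≤ x → 1# ≤ y → 1# ≤ x * y
  1≤x⇒1≤y⇒1≤x*y {x} {y} 1≤x 1≤y = subst (_≤ x * y) (*-identityʳ 1#) (*-mono-≤ 0≤1 1≤x 0≤1 1≤y)

  ^-nonneg : ∀ {x} n → 0# ≤ x → 0# ≤ x ^ n
  ^-nonneg zero     _   = 0≤1
  ^-nonneg (sucℕ n) 0≤x = *-nonneg 0≤x (^-nonneg n 0≤x)

  ^-monoˡ-≤ : ∀ {x y} n → 0# ≤ x → x ≤ y → x ^ n ≤ y ^ n
  ^-monoˡ-≤ zero     _   _   = ≤-refl
  ^-monoˡ-≤ (sucℕ n) 0≤x x≤y = *-mono-≤ 0≤x x≤y (^-nonneg n 0≤x) (^-monoˡ-≤ n 0≤x x≤y)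

  1≤x⇒1≤x^n : ∀ {x} n → 1# ≤ x → 1# ≤ x ^ n
  1≤x⇒1≤x^n zero     _   = ≤-refl
  1≤x⇒1≤x^n (sucℕ n) 1≤x = 1≤x⇒1≤y⇒1≤x*y 1≤x (1≤x⇒1≤x^n n 1≤x)

  ^-monoʳ-≤ : ∀ {x m n} → 1# ≤ x → m ≤ℕ n → x ^ m ≤ x ^ n
  ^-monoʳ-≤ {n = n} 1≤x z≤n = 1≤x⇒1≤x^n n 1≤x
  ^-monoʳ-≤ {m = sucℕ m} 1≤x (s≤s m≤n) =
    *-mono-≤ 0≤x ≤-refl (^-nonneg m 0≤x) (^-monoʳ-≤ 1≤x m≤n)
    where 0≤x = ≤-trans 0≤1 1≤x

  ^-distribʳ-* : ∀ x y n → (x * y) ^ n ≡ x ^ n * y ^ n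
  ^-distribʳ-* x y zero     = sym (*-identityʳ 1#)
  ^-distribʳ-* x y (sucℕ n) = begin
    x * y * (x * y) ^ n         ≡⟨ cong (x * y *_) (^-distribʳ-* x y n) ⟩
    x * y * (x ^ n * y ^ n)     ≡⟨ solve 4 (λ x y p q → x :* y :* (p :* q) := x :* p :* (y :* q)) refl x y (x ^ n) (y ^ n) ⟩
    x * x ^ n * (y * y ^ n)     ∎
    where open ≡-Reasoning

  ^-zeroˡ : ∀ n → 1# ^ n ≡ 1#
  ^-zeroˡ zero     = refl
  ^-zeroˡ (sucℕ n) = trans (cong (1# *_) (^-zeroˡ n)) (*-identityʳ 1#)

  x^[1+n]+y≤[x+y]^[1+n] : ∀ {x y} n → 1# ≤ x → 0# ≤ y → x ^ sucℕ n + y ≤ (x + y) ^ sucℕ n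
  x^[1+n]+y≤[x+y]^[1+n] {x} {y} n 1≤x 0≤y = begin
    x * x ^ n + y            ≡⟨ cong (x * x ^ n +_) (sym (*-identityʳ y)) ⟩
    x * x ^ n + y * 1#       ≤⟨ +-monoʳ-≤ (x * x ^ n) (*-mono-≤ 0≤y ≤-refl 0≤1 (1≤x⇒1≤x^n n 1≤x)) ⟩
    x * x ^ n + y * x ^ n    ≡⟨ sym (distribʳ (x ^ n) x y) ⟩
    (x + y) * x ^ n          ≤⟨ *-mono-≤ 0≤x+y ≤-refl (^-nonneg n 0≤x) (^-monoˡ-≤ n 0≤x (x≤x+y x 0≤y)) ⟩
    (x + y) * (x + y) ^ n    ∎
    where
    0≤x = ≤-trans 0≤1 1≤x
    0≤x+y = +-nonneg 0≤x 0≤y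
    open ≤-Reasoning

  t^m≤[t+g]^n : ∀ {t g m n} → 1# ≤ t → 0# ≤ g → m ≤ℕ n → t ^ m ≤ (t + g) ^ n
  t^m≤[t+g]^n {t} {n = n} 1≤t 0≤g m≤n =
    ≤-trans (^-monoʳ-≤ 1≤t m≤n) (^-monoˡ-≤ n (≤-trans 0≤1 1≤t) (x≤x+y t 0≤g))

  t^m≡[t+g]^[1+n]⇒g≡0 : ∀ {t g m} n → 1# ≤ t → 0# ≤ g → m ≤ℕ sucℕ n →
                        t ^ m ≡ (t + g) ^ sucℕ n → g ≡ 0#
  t^m≡[t+g]^[1+n]⇒g≡0 {t} {g} {m} n 1≤t 0≤g m≤1+n t^m≡[t+g]^[1+n] =
    ≤-antisym (x+y≤x⇒y≤0 t^m+g≤t^m) 0≤g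
    where
    open ≤-Reasoning
    t^m+g≤t^m : t ^ m + g ≤ t ^ m
    t^m+g≤t^m = begin
      t ^ m + g          ≤⟨ +-mono-≤ g (^-monoʳ-≤ 1≤t m≤1+n) ⟩
      t ^ sucℕ n + g     ≤⟨ x^[1+n]+y≤[x+y]^[1+n] n 1≤t 0≤g ⟩
      (t + g) ^ sucℕ n   ≡⟨ sym t^m≡[t+g]^[1+n] ⟩
      t ^ m              ∎

  fromℕ-nonneg : ∀ n → 0# ≤ fromℕ n
  fromℕ-nonneg zero     = ≤-refl
  fromℕ-nonneg (sucℕ n) = +-nonneg 0≤1 (fromℕ-nonneg n)

  fromℕ-+1 : ∀ n → fromℕ (n +ℕ 1) ≡ fromℕ n + 1#
  fromℕ-+1 zero     = +-comm 1# 0#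
  fromℕ-+1 (sucℕ n) = trans (cong (1# +_) (fromℕ-+1 n)) (sym (+-assoc 1# (fromℕ n) 1#))

  module Proposition3p6 (e : ℕ) (x y : Carrier) (0≤x : 0# ≤ x) (0≤y : 0# ≤ y) where
    d : ℕ
    d = sucℕ e

    D t g lhs rhs : Carrier
    D = fromℕ d
    t = (D * x + 1#) * (D * y + 1#)
    g = x + (y + D * x * y)
    lhs = (D * x + 1#) ^ (d +ℕ 1) * (D * y + 1#) ^ (d +ℕ 1)
    rhs = (fromℕ (d +ℕ 1) * D * x * y + fromℕ (d +ℕ 1) * (x + y) + 1#) ^ (2 *ℕ d)

    lhs≡t^[d+1] : lhs ≡ t ^ (d +ℕ 1)
    lhs≡t^[d+1] = sym (^-distribʳ-* (D * x + 1#) (D * y + 1#) (d +ℕ 1))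

    rhs≡[t+g]^2d : rhs ≡ (t + g) ^ (2 *ℕ d)
    rhs≡[t+g]^2d = cong (_^ (2 *ℕ d)) (begin
      fromℕ (d +ℕ 1) * D * x * y + fromℕ (d +ℕ 1) * (x + y) + 1#
        ≡⟨ cong (λ D₁ → D₁ * D * x * y + D₁ * (x + y) + 1#) (fromℕ-+1 d) ⟩
      (D + 1#) * D * x * y + (D + 1#) * (x + y) + 1#
        ≡⟨ solve 3 (λ D x y → (D :+ con 1) :* D :* x :* y :+ (D :+ con 1) :* (x :+ y) :+ con 1
                            := (D :* x :+ con 1) :* (D :* y :+ con 1) :+ (x :+ (y :+ D :* x :* y)))
                   refl D x y ⟩
      t + g
        ∎)
      where open ≡-Reasoning

    0≤Dxy : 0# ≤ D * x * y
    0≤Dxy = *-nonneg (*-nonneg (fromℕ-nonneg d) 0≤x) 0≤y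

    1≤t : 1# ≤ t
    1≤t = 1≤x⇒1≤y⇒1≤x*y (x≤y+x 1# (*-nonneg (fromℕ-nonneg d) 0≤x))
                         (x≤y+x 1# (*-nonneg (fromℕ-nonneg d) 0≤y))

    0≤g : 0# ≤ g
    0≤g = +-nonneg 0≤x (+-nonneg 0≤y 0≤Dxy)

    d+1≤2d : d +ℕ 1 ≤ℕ 2 *ℕ d
    d+1≤2d = n+1≤2n (s≤s z≤n)

    lhs≤rhs : lhs ≤ rhs
    lhs≤rhs = subst₂ _≤_ (sym lhs≡t^[d+1]) (sym rhs≡[t+g]^2d) (t^m≤[t+g]^n 1≤t 0≤g d+1≤2d)

    lhs≡rhs⇒x≡0×y≡0 : lhs ≡ rhs → x ≡ 0# × y ≡ 0#
    lhs≡rhs⇒x≡0×y≡0 lhs≡rhs =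
      x+y≡0⇒x≡0 0≤x (+-nonneg 0≤y 0≤Dxy) g≡0 ,
      x+y≡0⇒x≡0 0≤y 0≤Dxy (x+y≡0⇒y≡0 0≤x (+-nonneg 0≤y 0≤Dxy) g≡0)
      where
      g≡0 : g ≡ 0#
      g≡0 = t^m≡[t+g]^[1+n]⇒g≡0 _ 1≤t 0≤g d+1≤2d
              (trans (sym lhs≡t^[d+1]) (trans lhs≡rhs rhs≡[t+g]^2d))

    x≡0×y≡0⇒lhs≡rhs : x ≡ 0# × y ≡ 0# → lhs ≡ rhs
    x≡0×y≡0⇒lhs≡rhs (x≡0 , y≡0) = begin
      lhs                ≡⟨ lhs≡t^[d+1] ⟩
      t ^ (d +ℕ 1)       ≡⟨ cong (_^ (d +ℕ 1)) t≡1 ⟩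
      1# ^ (d +ℕ 1)      ≡⟨ ^-zeroˡ (d +ℕ 1) ⟩
      1#                 ≡⟨ sym (^-zeroˡ (2 *ℕ d)) ⟩
      1# ^ (2 *ℕ d)      ≡⟨ cong (_^ (2 *ℕ d)) (sym t+g≡1) ⟩
      (t + g) ^ (2 *ℕ d) ≡⟨ sym rhs≡[t+g]^2d ⟩
      rhs                ∎
      where
      open ≡-Reasoning
      t≡1 : t ≡ 1#
      t≡1 = trans (cong₂ (λ u v → (D * u + 1#) * (D * v + 1#)) x≡0 y≡0)
                  (solve 1 (λ D → (D :* con 0 :+ con 1) :* (D :* con 0 :+ con 1) := con 1) refl D)
      g≡0 : g ≡ 0#
      g≡0 = trans (cong₂ (λ u v → u + (v + D * u * v)) x≡0 y≡0)
                  (solve 1 (λ D → con 0 :+ (con 0 :+ D :* con 0 :* con 0) := con 0) refl D)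
      t+g≡1 : t + g ≡ 1#
      t+g≡1 = trans (cong₂ _+_ t≡1 g≡0) (+-identityʳ 1#)

-- Opened only now, as RealFieldProperties defines R-specialised fromℕ and _^_ of its own.
open Defs using (fromℕ; _^_)

proposition3p6 : ∀ {c : Level} (R : RealField c) → let open RealField R in
    (d : ℕ) → 1 ≤ℕ d → (x y : Carrier) → 0# ≤ x → 0# ≤ y →
    let D = fromℕ R d
        D1 = fromℕ R (d +ℕ 1)
        lhs = (_^_ R (D * x + 1#) (d +ℕ 1)) * (_^_ R (D * y + 1#) (d +ℕ 1))
        rhs = _^_ R (D1 * D * x * y + D1 * (x + y) + 1#) (2 *ℕ d)
    in (lhs ≤ rhs) × ((lhs ≡ rhs → (x ≡ 0# × y ≡ 0#)) × ((x ≡ 0# × y ≡ 0#) → lhs ≡ rhs))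
proposition3p6 R zero () _ _ _ _
proposition3p6 R (sucℕ e) _ x y 0≤x 0≤y = lhs≤rhs , lhs≡rhs⇒x≡0×y≡0 , x≡0×y≡0⇒lhs≡rhs
  where open RealFieldProperties.Proposition3p6 R e x y 0≤x 0≤y
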